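{- Let $p,q>1$ be relatively prime integers. If $U\notin\mathbb{N}$ then $W(U)=0$. For every integer $U\ge1$, $$W(U)=W_p(U)+W\!\left(\frac{U}{q}\right)+\sum_{c=0}^{\lfloor\log_p(U/(q+1))\rfloor}\delta_{p,q}(c,U)\,W\!\left(\left\lfloor\frac{U}{p^cq}\right\rfloor\right),$$ where $\delta_{p,q}(c,U)=1$ if $\lfloor U/p^c\rfloor\equiv1\pmod q$ and $W_p(U\bmod p^c)=1$, and $\delta_{p,q}(c,U)=0$ otherwise.
   Context: A strictly chained $(p,q)$-ary partition of $U$ is a finite sequence of distinct positive integers of the form $p^aq^b$ ($a,b\ge0$) summing to $U$, in decreasing order, each part a multiple of the next. $W(U)$ is the number of such partitions of $U$, with $W(0)=1$ and $W(x)=0$ if $x$ is not a nonnegative integer. $W_p(U)\in\{0,1\}$ is the number of partitions of $U$ into distinct parts that are powers of $p$ (i.e. $W_p(U)=1$ iff $U$ has a base-$p$ expansion using only digits $0$ and $1$); $W_p(0)=1$. -}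

module Defs where

open import Data.Nat using (ℕ; zero; suc; _+_; _*_; _^_; _≤_; _<_; _>_; _≟_; _<?_; _≤?_)
open import Data.Nat.Divisibility using (_∣_; _∣?_)
open import Data.Nat.DivMod using (_/_; _%_)
open import Data.Nat.ListAction using (sum)
open import Data.List using (List; []; _∷_; map; length; filter; upTo; _++_)
open import Data.List.Relation.Unary.All using (All; all?)
open import Data.List.Relation.Unary.Any using (Any; any?)
open import Data.List.Relation.Unary.Linked using (Linked; linked?)
open import Data.Product using (_×_)
open import Relation.Nullary.Decidable using (Dec; _×-dec_; does)
open import Data.Bool using (if_then_else_)

sublists : List ℕ → List (List ℕ)
sublists [] = [] ∷ []
sublists (x ∷ xs) = map (x ∷_) (sublists xs) ++ sublists xs

downFrom1 : ℕ → List ℕ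
downFrom1 zero = []
downFrom1 (suc n) = suc n ∷ downFrom1 n

-- x is of the form p^a q^b (a, b ≥ 0).  The search is bounded by a, b ≤ x,
-- which loses nothing for x ≥ 1 and p, q > 1 (then p^a, q^b ≤ x forces a, b < x).
IsPQ : ℕ → ℕ → ℕ → Set
IsPQ p q x = Any (λ a → Any (λ b → p ^ a * q ^ b ≡ x) (upTo (suc x))) (upTo (suc x))
  where open import Relation.Binary.PropositionalEquality using (_≡_)

isPQ? : ∀ p q x → Dec (IsPQ p q x)
isPQ? p q x = any? (λ a → any? (λ b → p ^ a * q ^ b ≟ x) (upTo (suc x))) (upTo (suc x))

-- x is a power of p  (bounded search a ≤ x, harmless for x ≥ 1, p > 1)
IsPow : ℕ → ℕ → Set
IsPow p x = Any (λ a → p ^ a ≡ x) (upTo (suc x))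
  where open import Relation.Binary.PropositionalEquality using (_≡_)

isPow? : ∀ p x → Dec (IsPow p x)
isPow? p x = any? (λ a → p ^ a ≟ x) (upTo (suc x))

open import Relation.Binary.PropositionalEquality using (_≡_)

Chained : ℕ → ℕ → Set
Chained x y = y < x × y ∣ x

chained? : ∀ x y → Dec (Chained x y)
chained? x y = (y <? x) ×-dec (y ∣? x)

-- xs is a strictly chained (p,q)-ary partition of U
-- (parts are positive since candidates are drawn from [U, ..., 1])
IsSCP : ℕ → ℕ → ℕ → List ℕ → Set
IsSCP p q U xs = All (IsPQ p q) xs × Linked Chained xs × sum xs ≡ U

isSCP? : ∀ p q U xs → Dec (IsSCP p q U xs)
isSCP? p q U xs = all? (isPQ? p q) xs ×-dec (linked? chained? xs ×-dec (sum xs ≟ U))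

-- Any such partition is a decreasing list of distinct elements of {1..U},
-- i.e. a sublist of [U, ..., 1]; we count those satisfying IsSCP.
W : ℕ → ℕ → ℕ → ℕ
W p q U = length (filter (isSCP? p q U) (sublists (downFrom1 U)))

IsPPart : ℕ → ℕ → List ℕ → Set
IsPPart p U xs = All (IsPow p) xs × Linked (λ x y → y < x) xs × sum xs ≡ U

isPPart? : ∀ p U xs → Dec (IsPPart p U xs)
isPPart? p U xs = all? (isPow? p) xs ×-dec (linked? (λ x y → y <? x) xs ×-dec (sum xs ≟ U))

Wp : ℕ → ℕ → ℕ
Wp p U = length (filter (isPPart? p U) (sublists (downFrom1 U)))

-- floor division / remainder, total (value 0 for divisor 0; only used with d ≥ 1)
fdiv : ℕ → ℕ → ℕ
fdiv n zero = 0
fdiv n (suc d) = n / suc d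

fmod : ℕ → ℕ → ℕ
fmod n zero = n
fmod n (suc d) = n % suc d

-- W at the rational number n/d (d ≥ 1): W(n/d) if d ∣ n, and 0 otherwise
-- (the convention W(x) = 0 for x ∉ ℕ).
Wfrac : ℕ → ℕ → ℕ → ℕ → ℕ
Wfrac p q n d = if does (d ∣? n) then W p q (fdiv n d) else 0

δ : ℕ → ℕ → ℕ → ℕ → ℕ
δ p q c U = if does (fmod (fdiv U (p ^ c)) q ≟ fmod 1 q) then
              (if does (Wp p (fmod U (p ^ c)) ≟ 1) then 1 else 0) else 0

-- The range c ≤ ⌊log_p(U/(q+1))⌋ is exactly p^c (q+1) ≤ U (empty when U < q+1);
-- every such c satisfies c < U + 1 (p > 1), so we sum over c ∈ [0..U].
sumTerm : ℕ → ℕ → ℕ → ℕ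
sumTerm p q U = sum (map term (upTo (suc U)))
  where
  term : ℕ → ℕ
  term c = if does (p ^ c * (q + 1) ≤? U)
             then δ p q c U * W p q (fdiv U (p ^ c * q)) else 0

module Submission where

-- Let p, q > 1 be coprime and U ≥ 1.  Every strictly chained partition xs
-- of U lies in exactly one of three classes:
--   * pure:   its largest part is not a multiple of q.  Every part divides
--             the largest one, so all parts are powers of p: these are the
--             partitions of U into distinct powers of p, counted by W_p(U);
--   * all-q:  every part is a multiple of q, so xs = q·ys with ys a
--             partition of U/q; there are W(U/q) of them (0 if q ∤ U);
--   * mixed:  the largest part is a multiple of q but the first part p^c
--             that is not is preceded only by multiples of p^c q.  Then
--             xs = (p^c q)·ys ++ p^c ∷ zs, where ys partitions M ≥ 1 and zs
--             partitions T < p^c into distinct powers of p, and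
--             U = p^c q M + p^c + T.  Such a decomposition exists exactly
--             when δ(c,U) = 1 (and p^c (q+1) ≤ U), and then M = ⌊U/(p^c q)⌋.  Theorem 4.2 is the sum of the three counts.

open import Defs
open import Data.Bool using (if_then_else_)
open import Data.Empty using (⊥; ⊥-elim)
open import Data.List using (List; []; _∷_; map; length; filter; upTo; _++_)
open import Data.List.Properties using (length-map; upTo-∷ʳ; map-++; map-cong; map-injective; ++-cancelʳ; ∷-injectiveʳ; filter-none; filter-≐)
open import Data.List.Membership.Propositional using (_∈_; find; lose)
open import Data.List.Membership.Propositional.Properties using (∈-map⁺; ∈-map⁻; ∈-++⁺ˡ; ∈-++⁺ʳ; ∈-++⁻; ∈-filter⁺; ∈-filter⁻; ∈-upTo⁺; ∈-upTo⁻)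
open import Data.List.Membership.Propositional.Properties.WithK using (unique∧set⇒bag)
open import Data.List.Relation.Binary.BagAndSetEquality using (∼bag⇒↭)
open import Data.List.Relation.Binary.Permutation.Propositional.Properties using (↭-length)
open import Data.List.Relation.Unary.All using (All; []; _∷_)
import Data.List.Relation.Unary.All as All
import Data.List.Relation.Unary.All.Properties as AllP
open import Data.List.Relation.Unary.AllPairs using (AllPairs; []; _∷_)
import Data.List.Relation.Unary.AllPairs as AllPairs
import Data.List.Relation.Unary.AllPairs.Properties as AllPairsP
open import Data.List.Relation.Unary.Any using (Any; here; any?)
import Data.List.Relation.Unary.Any as Any
open import Data.List.Relation.Unary.Linked.Properties using (Linked⇒AllPairs; AllPairs⇒Linked)
open import Data.List.Relation.Unary.Unique.Propositional using (Unique)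
import Data.List.Relation.Unary.Unique.Propositional.Properties as UniqueP
open import Data.Nat
open import Data.Nat.Properties
open import Data.Nat.Coprimality using (Coprime; coprime-divisor) renaming (sym to coprime-sym)
open import Data.Nat.Divisibility using (_∣_; _∣?_; divides; ∣-trans; ∣1⇒≡1; *-cancelˡ-∣; *-monoʳ-∣; ∣m∣n⇒∣m+n; _∣0; n∣m*n; m∣m*n)
open import Data.Nat.DivMod using (m≡m%n+[m/n]*n; m%n<n; m<n⇒m%n≡m; m<n⇒m/n≡0; m*n/n≡m; [m+kn]%n≡m%n; +-distrib-/-∣ʳ; m/n/o≡m/[n*o]; m≥n⇒m/n>0)
open import Data.Nat.ListAction using (sum)
open import Data.Nat.ListAction.Properties using (sum-++)
open import Data.Nat.Tactic.RingSolver using (solve-∀)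
open import Data.Product using (∃; _×_; _,_; proj₁; proj₂)
open import Data.Sum using (_⊎_; inj₁; inj₂; [_,_])
open import Function using (_∘_)
open import Function.Bundles using (_⇔_; mk⇔)
open import Level using (0ℓ)
open import Relation.Binary using (tri<; tri≈; tri>)
open import Relation.Binary.PropositionalEquality hiding ([_])
open import Relation.Nullary using (Dec; yes; no; ¬_)
open import Relation.Nullary.Decidable using (_×-dec_; ¬?; does)
open import Relation.Unary using (Pred; Decidable)

length-by-members : {A : Set} {xs ys : List A} → Unique xs → Unique ys →
                    (∀ {z} → z ∈ xs ⇔ z ∈ ys) → length xs ≡ length ys
length-by-members u v same = ↭-length (∼bag⇒↭ (unique∧set⇒bag u v same))

length-by-bijection : {A B : Set} {xs : List A} {ys : List B} → Unique xs → Unique ys →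
  (f : A → B) → (∀ {a b} → f a ≡ f b → a ≡ b) →
  (∀ {a} → a ∈ xs → f a ∈ ys) → (∀ {b} → b ∈ ys → ∃ λ a → a ∈ xs × b ≡ f a) →
  length xs ≡ length ys
length-by-bijection {xs = xs} {ys} u v f f-inj into onto =
  trans (sym (length-map f xs)) (length-by-members (UniqueP.map⁺ f-inj u) v (mk⇔ to from))
  where
  to : ∀ {b} → b ∈ map f xs → b ∈ ys
  to b∈ with a , a∈ , refl ← ∈-map⁻ f b∈ = into a∈
  from : ∀ {b} → b ∈ ys → b ∈ map f xs
  from b∈ with a , a∈ , refl ← onto b∈ = ∈-map⁺ f a∈

nonempty-member : {A : Set} (xs : List A) → 1 ≤ length xs → ∃ (_∈ xs)
nonempty-member (x ∷ _) _ = x , here refl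

module _ {A : Set} {P Q R : Pred A 0ℓ} (P? : Decidable P) (Q? : Decidable Q) (R? : Decidable R)
         (split : ∀ {x} → P x → Q x ⊎ R x) (Q⇒P : ∀ {x} → Q x → P x) (R⇒P : ∀ {x} → R x → P x)
         (disjoint : ∀ {x} → Q x → R x → ⊥) where

  length-filter-split : (xs : List A) →
    length (filter P? xs) ≡ length (filter Q? xs) + length (filter R? xs)
  length-filter-split [] = refl
  length-filter-split (x ∷ xs) with P? x | Q? x | R? x
  ... | _      | yes qx | yes rx = ⊥-elim (disjoint qx rx)
  ... | yes _  | yes _  | no _   = cong suc (length-filter-split xs)
  ... | yes _  | no _   | yes _  = trans (cong suc (length-filter-split xs)) (sym (+-suc _ _))
  ... | yes px | no ¬qx | no ¬rx = ⊥-elim ([ ¬qx , ¬rx ] (split px))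
  ... | no ¬px | yes qx | _      = ⊥-elim (¬px (Q⇒P qx))
  ... | no ¬px | no _   | yes rx = ⊥-elim (¬px (R⇒P rx))
  ... | no _   | no _   | no _   = length-filter-split xs

sum-upTo-suc : (f : ℕ → ℕ) (n : ℕ) → sum (map f (upTo (suc n))) ≡ sum (map f (upTo n)) + f n
sum-upTo-suc f n = begin
  sum (map f (upTo (suc n)))        ≡⟨ cong (sum ∘ map f) (sym (upTo-∷ʳ n)) ⟩
  sum (map f (upTo n ++ n ∷ []))    ≡⟨ cong sum (map-++ f (upTo n) (n ∷ [])) ⟩
  sum (map f (upTo n) ++ f n ∷ [])  ≡⟨ sum-++ (map f (upTo n)) (f n ∷ []) ⟩
  sum (map f (upTo n)) + (f n + 0)  ≡⟨ cong (sum (map f (upTo n)) +_) (+-identityʳ (f n)) ⟩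
  sum (map f (upTo n)) + f n        ∎
  where open ≡-Reasoning

head₀ : List ℕ → ℕ
head₀ [] = 0
head₀ (x ∷ _) = x

all-≤-sum : ∀ xs → All (_≤ sum xs) xs
all-≤-sum [] = []
all-≤-sum (x ∷ xs) = m≤m+n x (sum xs) ∷ All.map (λ h → ≤-trans h (m≤n+m (sum xs) x)) (all-≤-sum xs)

sum-map-* : ∀ d xs → sum (map (d *_) xs) ≡ d * sum xs
sum-map-* d [] = sym (*-zeroʳ d)
sum-map-* d (x ∷ xs) = trans (cong (d * x +_) (sum-map-* d xs)) (sym (*-distribˡ-+ d x (sum xs)))

all-multiples : ∀ d xs → All (d ∣_) xs → ∃ λ ys → xs ≡ map (d *_) ys
all-multiples d [] [] = [] , refl
all-multiples d (x ∷ xs) (divides k refl ∷ hs) with ys , refl ← all-multiples d xs hs =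
  k ∷ ys , cong (_∷ map (d *_) ys) (*-comm k d)

multiples-map : ∀ d ys → All (d ∣_) (map (d *_) ys)
multiples-map d ys = AllP.map⁺ (All.universal m∣m*n ys)

multiples-sum : ∀ {d} xs → All (d ∣_) xs → d ∣ sum xs
multiples-sum [] [] = _ ∣0
multiples-sum (x ∷ xs) (d∣x ∷ ds) = ∣m∣n⇒∣m+n d∣x (multiples-sum xs ds)

multiples-head : ∀ {d} xs → All (d ∣_) xs → d ∣ head₀ xs
multiples-head [] _ = _ ∣0
multiples-head (x ∷ _) (d∣x ∷ _) = d∣x

AllPairs-++⁻ : ∀ {R : ℕ → ℕ → Set} xs {ys} → AllPairs R (xs ++ ys) →
               AllPairs R xs × AllPairs R ys × All (λ x → All (R x) ys) xs
AllPairs-++⁻ [] h = [] , h , []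
AllPairs-++⁻ (x ∷ xs) (a ∷ h) with h₁ , h₂ , h₃ ← AllPairs-++⁻ xs h =
  (AllP.++⁻ˡ xs a ∷ h₁) , h₂ , (AllP.++⁻ʳ xs a ∷ h₃)

Decreasing : List ℕ → Set
Decreasing = AllPairs (λ x y → y < x)

Chained-trans : ∀ {x y z} → Chained x y → Chained y z → Chained x z
Chained-trans (y<x , y∣x) (z<y , z∣y) = <-trans z<y y<x , ∣-trans z∣y y∣x

sublist-bounded : ∀ N {xs} → xs ∈ sublists (downFrom1 N) → All (_≤ N) xs
sublist-bounded zero (here refl) = []
sublist-bounded (suc N) m with ∈-++⁻ (map (suc N ∷_) (sublists (downFrom1 N))) m
... | inj₂ m′ = All.map m≤n⇒m≤1+n (sublist-bounded N m′)
... | inj₁ m′ with ∈-map⁻ (suc N ∷_) m′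
...   | ys , ys∈ , refl = ≤-refl ∷ All.map m≤n⇒m≤1+n (sublist-bounded N ys∈)

sublists-unique : ∀ N → Unique (sublists (downFrom1 N))
sublists-unique zero = [] ∷ []
sublists-unique (suc N) =
  UniqueP.++⁺ (UniqueP.map⁺ ∷-injectiveʳ (sublists-unique N)) (sublists-unique N) disjoint
  where
  disjoint : ∀ {v} → ¬ (v ∈ map (suc N ∷_) (sublists (downFrom1 N)) × v ∈ sublists (downFrom1 N))
  disjoint (m₁ , m₂) with ∈-map⁻ (suc N ∷_) m₁
  ... | _ , _ , refl with sublist-bounded N m₂
  ...   | N+1≤N ∷ _ = <-irrefl refl N+1≤N

decreasing⇒sublist : ∀ N {xs} → Decreasing xs → All (λ x → 0 < x × x ≤ N) xs →
                     xs ∈ sublists (downFrom1 N)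
decreasing⇒sublist zero {[]} _ _ = here refl
decreasing⇒sublist zero {x ∷ _} _ ((0<x , x≤0) ∷ _) = ⊥-elim (<⇒≱ 0<x x≤0)
decreasing⇒sublist (suc N) {[]} _ _ = ∈-++⁺ʳ _ (decreasing⇒sublist N [] [])
decreasing⇒sublist (suc N) {x ∷ xs} (below ∷ dec) ((0<x , x≤N+1) ∷ bounds) with x ≟ suc N
... | yes refl = ∈-++⁺ˡ (∈-map⁺ (suc N ∷_) (decreasing⇒sublist N dec
                   (All.zipWith (λ (y<x , 0<y , _) → 0<y , ≤-pred y<x) (below , bounds))))
... | no x≢N+1 = ∈-++⁺ʳ _ (decreasing⇒sublist N (below ∷ dec) ((0<x , x≤N) ∷
                   All.zipWith (λ (y<x , 0<y , _) → 0<y , ≤-trans (<⇒≤ y<x) x≤N) (below , bounds)))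
  where x≤N = ≤-pred (≤∧≢⇒< x≤N+1 x≢N+1)

positive-decreasing⇒candidate : ∀ {xs} → All (0 <_) xs → Decreasing xs →
                                xs ∈ sublists (downFrom1 (sum xs))
positive-decreasing⇒candidate {xs} pos dec =
  decreasing⇒sublist (sum xs) dec (All.zip (pos , all-≤-sum xs))

n<m^n : ∀ {m} → 1 < m → ∀ n → n < m ^ n
n<m^n 1<m zero = s≤s z≤n
n<m^n {m} 1<m (suc n) = begin-strict
  suc n          <⟨ s≤s (n<m^n 1<m n) ⟩
  suc (m ^ n)    ≡⟨ +-comm 1 (m ^ n) ⟩
  m ^ n + 1      ≤⟨ +-monoʳ-≤ (m ^ n) (m^n>0 m n) ⟩
  m ^ n + m ^ n  ≡⟨ cong (m ^ n +_) (sym (+-identityʳ (m ^ n))) ⟩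
  2 * m ^ n      ≤⟨ *-monoˡ-≤ (m ^ n) 1<m ⟩
  m * m ^ n      ∎
  where open ≤-Reasoning
        instance _ : NonZero m
                 _ = >-nonZero (<-trans z<s 1<m)

coprime-divisor-^ : ∀ {m n} → Coprime m n → ∀ c {k} → m ∣ n ^ c * k → m ∣ k
coprime-divisor-^ {m} m⊥n zero {k} h = subst (m ∣_) (+-identityʳ k) h
coprime-divisor-^ {m} {n} m⊥n (suc c) {k} h =
  coprime-divisor-^ m⊥n c (coprime-divisor m⊥n (subst (m ∣_) (*-assoc n (n ^ c) k) h))

coprime-∤-^ : ∀ {m n} → 1 < m → Coprime m n → ∀ c → ¬ (m ∣ n ^ c)
coprime-∤-^ {m} {n} 1<m m⊥n c h =
  <⇒≢ 1<m (sym (∣1⇒≡1 (coprime-divisor-^ m⊥n c (subst (m ∣_) (sym (*-identityʳ (n ^ c))) h))))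

div-mod-unique : ∀ {d} .{{_ : NonZero d}} r t → r < d →
                 (r + t * d) / d ≡ t × (r + t * d) % d ≡ r
div-mod-unique {d} r t r<d = quotient , trans ([m+kn]%n≡m%n r t d) (m<n⇒m%n≡m r<d)
  where
  open ≡-Reasoning
  quotient : (r + t * d) / d ≡ t
  quotient = begin
    (r + t * d) / d    ≡⟨ +-distrib-/-∣ʳ r (n∣m*n t) ⟩
    r / d + t * d / d  ≡⟨ cong₂ _+_ (m<n⇒m/n≡0 r<d) (m*n/n≡m t d) ⟩
    t                  ∎

fdiv≡/ : ∀ n d .{{_ : NonZero d}} → fdiv n d ≡ n / d
fdiv≡/ n (suc d) = refl

fmod≡% : ∀ n d .{{_ : NonZero d}} → fmod n d ≡ n % d
fmod≡% n (suc d) = refl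

interchange : ∀ w x y z → w * x * (y * z) ≡ w * y * (x * z)
interchange = solve-∀

left-comm : ∀ x y z → x * (y * z) ≡ y * (x * z)
left-comm = solve-∀

shape-by-P : ∀ P q M T → P * q * M + (P + T) ≡ T + (1 + M * q) * P
shape-by-P = solve-∀

shape-by-Pq : ∀ P q M T → P * q * M + (P + T) ≡ P + T + M * (P * q)
shape-by-Pq = solve-∀

double : ∀ P → P + P ≡ P * 2
double = solve-∀

P[q+1] : ∀ P q → P * (q + 1) ≡ P * q * 1 + (P + 0)
P[q+1] = solve-∀

module DeltaConditions {q : ℕ} .{{_ : NonZero q}} (1<q : 1 < q)
                       {P : ℕ} .{{_ : NonZero P}} .{{_ : NonZero (P * q)}} where

  shape⇒conditions : ∀ {U M T} → U ≡ P * q * M + (P + T) → T < P → 1 ≤ M →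
    P * (q + 1) ≤ U × fmod (fdiv U P) q ≡ fmod 1 q × fmod U P ≡ T × fdiv U (P * q) ≡ M
  shape⇒conditions {U} {M} {T} U≡ T<P 1≤M = bound , digit , remainder , quotient
    where
    U≡byP : U ≡ T + (1 + M * q) * P
    U≡byP = trans U≡ (shape-by-P P q M T)
    byP = div-mod-unique T (1 + M * q) T<P
    remainder : fmod U P ≡ T
    remainder = trans (fmod≡% U P) (trans (cong (_% P) U≡byP) (proj₂ byP))
    digit : fmod (fdiv U P) q ≡ fmod 1 q
    digit = begin
      fmod (fdiv U P) q  ≡⟨ fmod≡% (fdiv U P) q ⟩
      fdiv U P % q       ≡⟨ cong (_% q) (trans (fdiv≡/ U P) (trans (cong (_/ P) U≡byP) (proj₁ byP))) ⟩
      (1 + M * q) % q    ≡⟨ proj₂ (div-mod-unique 1 M 1<q) ⟩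
      1                  ≡⟨ sym (trans (fmod≡% 1 q) (m<n⇒m%n≡m 1<q)) ⟩
      fmod 1 q           ∎
      where open ≡-Reasoning
    P+T<Pq : P + T < P * q
    P+T<Pq = begin-strict
      P + T  <⟨ +-monoʳ-< P T<P ⟩
      P + P  ≡⟨ double P ⟩
      P * 2  ≤⟨ *-monoʳ-≤ P 1<q ⟩
      P * q  ∎
      where open ≤-Reasoning
    quotient : fdiv U (P * q) ≡ M
    quotient = begin
      fdiv U (P * q)                 ≡⟨ fdiv≡/ U (P * q) ⟩
      U / (P * q)                    ≡⟨ cong (_/ (P * q)) (trans U≡ (shape-by-Pq P q M T)) ⟩
      (P + T + M * (P * q)) / (P * q) ≡⟨ proj₁ (div-mod-unique (P + T) M P+T<Pq) ⟩
      M                              ∎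
      where open ≡-Reasoning
    bound : P * (q + 1) ≤ U
    bound = begin
      P * (q + 1)            ≡⟨ P[q+1] P q ⟩
      P * q * 1 + (P + 0)    ≤⟨ +-mono-≤ (*-monoʳ-≤ (P * q) 1≤M) (+-monoʳ-≤ P z≤n) ⟩
      P * q * M + (P + T)    ≡⟨ sym U≡ ⟩
      U                      ∎
      where open ≤-Reasoning

  conditions⇒shape : ∀ {U} → P * (q + 1) ≤ U → fmod (fdiv U P) q ≡ fmod 1 q →
    U ≡ P * q * fdiv U (P * q) + (P + fmod U P) × fmod U P < P × 1 ≤ fdiv U (P * q)
  conditions⇒shape {U} bound digit =
    shape , subst (_< P) (sym (fmod≡% U P)) (m%n<n U P) , M≥1
    where
    open ≡-Reasoning
    M = U / P / q
    digit′ : U / P % q ≡ 1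
    digit′ = begin
      U / P % q          ≡⟨ cong (_% q) (sym (fdiv≡/ U P)) ⟩
      fdiv U P % q       ≡⟨ sym (fmod≡% (fdiv U P) q) ⟩
      fmod (fdiv U P) q  ≡⟨ digit ⟩
      fmod 1 q           ≡⟨ trans (fmod≡% 1 q) (m<n⇒m%n≡m 1<q) ⟩
      1                  ∎
    M≡ : fdiv U (P * q) ≡ M
    M≡ = trans (fdiv≡/ U (P * q)) (sym (m/n/o≡m/[n*o] U P q))
    shape : U ≡ P * q * fdiv U (P * q) + (P + fmod U P)
    shape = begin
      U                                 ≡⟨ m≡m%n+[m/n]*n U P ⟩
      U % P + U / P * P                 ≡⟨ cong (λ d → U % P + d * P) (m≡m%n+[m/n]*n (U / P) q) ⟩
      U % P + (U / P % q + M * q) * P   ≡⟨ cong (λ r → U % P + (r + M * q) * P) digit′ ⟩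
      U % P + (1 + M * q) * P           ≡⟨ sym (shape-by-P P q M (U % P)) ⟩
      P * q * M + (P + U % P)           ≡⟨ cong₂ (λ m t → P * q * m + (P + t)) (sym M≡) (sym (fmod≡% U P)) ⟩
      P * q * fdiv U (P * q) + (P + fmod U P) ∎
    M≥1 : 1 ≤ fdiv U (P * q)
    M≥1 = subst (1 ≤_) (sym (fdiv≡/ U (P * q)))
            (m≥n⇒m/n>0 (≤-trans (*-monoʳ-≤ P (m≤m+n q 1)) bound))

module _ (d : ℕ) where

  firstNonMultiple : List ℕ → ℕ
  firstNonMultiple [] = 0
  firstNonMultiple (x ∷ xs) with d ∣? x
  ... | yes _ = firstNonMultiple xs
  ... | no _  = x

  firstNonMultiple≡0 : ∀ xs → firstNonMultiple xs ≡ 0 → All (d ∣_) xs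
  firstNonMultiple≡0 [] _ = []
  firstNonMultiple≡0 (x ∷ xs) e with d ∣? x
  ... | yes d∣x = d∣x ∷ firstNonMultiple≡0 xs e
  ... | no d∤x  = ⊥-elim (d∤x (subst (d ∣_) (sym e) (d ∣0)))

  firstNonMultiple-++ : ∀ xs ys → All (d ∣_) xs → firstNonMultiple (xs ++ ys) ≡ firstNonMultiple ys
  firstNonMultiple-++ [] ys _ = refl
  firstNonMultiple-++ (x ∷ xs) ys (d∣x ∷ ds) with d ∣? x
  ... | yes _  = firstNonMultiple-++ xs ys ds
  ... | no d∤x = ⊥-elim (d∤x d∣x)

  firstNonMultiple-all : ∀ xs → All (d ∣_) xs → firstNonMultiple xs ≡ 0
  firstNonMultiple-all [] _ = refl
  firstNonMultiple-all (x ∷ xs) (d∣x ∷ ds) with d ∣? x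
  ... | yes _  = firstNonMultiple-all xs ds
  ... | no d∤x = ⊥-elim (d∤x d∣x)

  firstNonMultiple-∷ : ∀ {x} xs → ¬ (d ∣ x) → firstNonMultiple (x ∷ xs) ≡ x
  firstNonMultiple-∷ {x} xs d∤x with d ∣? x
  ... | yes d∣x = ⊥-elim (d∤x d∣x)
  ... | no _    = refl

  firstNonMultiple-split : ∀ xs → firstNonMultiple xs ≢ 0 →
    ∃ λ as → ∃ λ zs → xs ≡ as ++ firstNonMultiple xs ∷ zs × All (d ∣_) as × ¬ (d ∣ firstNonMultiple xs)
  firstNonMultiple-split [] ne = ⊥-elim (ne refl)
  firstNonMultiple-split (x ∷ xs) ne with d ∣? x
  ... | no d∤x = [] , xs , refl , [] , d∤x
  ... | yes d∣x with as , zs , e , ds , d∤ ← firstNonMultiple-split xs ne =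
    x ∷ as , zs , cong (x ∷_) e , d∣x ∷ ds , d∤

  firstNonMultiple-∈ : ∀ xs → firstNonMultiple xs ≢ 0 →
    firstNonMultiple xs ∈ xs × ¬ (d ∣ firstNonMultiple xs)
  firstNonMultiple-∈ xs ne with as , zs , e , _ , d∤ ← firstNonMultiple-split xs ne =
    subst (firstNonMultiple xs ∈_) (sym e) (∈-++⁺ʳ as (here refl)) , d∤

module Recurrence (p q : ℕ) (1<p : 1 < p) (1<q : 1 < q) (p⊥q : Coprime p q) where

  instance
    p≢0 : NonZero p
    p≢0 = >-nonZero (<-trans z<s 1<p)
    q≢0 : NonZero q
    q≢0 = >-nonZero (<-trans z<s 1<q)

  p^≢0 : ∀ c → NonZero (p ^ c)
  p^≢0 c = m^n≢0 p c

  PQ : ℕ → Set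
  PQ x = ∃ λ a → ∃ λ b → p ^ a * q ^ b ≡ x

  Pow : ℕ → Set
  Pow x = ∃ λ a → p ^ a ≡ x

  -- The bounded searches of Defs decide PQ and Pow, since exponents never
  -- exceed the number they produce.
  IsPQ⇒PQ : ∀ {x} → IsPQ p q x → PQ x
  IsPQ⇒PQ h = let (a , h′) = Any.satisfied h ; (b , e) = Any.satisfied h′ in a , b , e

  PQ⇒IsPQ : ∀ {x} → PQ x → IsPQ p q x
  PQ⇒IsPQ (a , b , refl) =
    Any.map (λ { refl → Any.map (λ { refl → refl }) (∈-upTo⁺ (s≤s b≤x)) }) (∈-upTo⁺ (s≤s a≤x))
    where
    a≤x : a ≤ p ^ a * q ^ b
    a≤x = ≤-trans (<⇒≤ (n<m^n 1<p a)) (m≤m*n (p ^ a) (q ^ b) {{m^n≢0 q b}})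
    b≤x : b ≤ p ^ a * q ^ b
    b≤x = ≤-trans (<⇒≤ (n<m^n 1<q b)) (m≤n*m (q ^ b) (p ^ a) {{p^≢0 a}})

  IsPow⇒Pow : ∀ {x} → IsPow p x → Pow x
  IsPow⇒Pow = Any.satisfied

  Pow⇒IsPow : ∀ {x} → Pow x → IsPow p x
  Pow⇒IsPow (a , refl) = Any.map (λ { refl → refl }) (∈-upTo⁺ (s≤s (<⇒≤ (n<m^n 1<p a))))

  PQ-pos : ∀ {x} → PQ x → 0 < x
  PQ-pos (a , b , refl) = *-mono-≤ (m^n>0 p a) (m^n>0 q b)

  Pow-pos : ∀ {x} → Pow x → 0 < x
  Pow-pos (a , refl) = m^n>0 p a

  PQ-* : ∀ {x y} → PQ x → PQ y → PQ (x * y)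
  PQ-* (a , b , refl) (c , d , refl) = a + c , b + d , (begin
    p ^ (a + c) * q ^ (b + d)        ≡⟨ cong₂ _*_ (^-distribˡ-+-* p a c) (^-distribˡ-+-* q b d) ⟩
    p ^ a * p ^ c * (q ^ b * q ^ d)  ≡⟨ interchange (p ^ a) (p ^ c) (q ^ b) (q ^ d) ⟩
    p ^ a * q ^ b * (p ^ c * q ^ d)  ∎)
    where open ≡-Reasoning

  Pow⇒PQ : ∀ {x} → Pow x → PQ x
  Pow⇒PQ (a , refl) = a , 0 , *-identityʳ (p ^ a)

  PQ-q : PQ q
  PQ-q = 0 , 1 , trans (*-identityˡ (q * 1)) (*-identityʳ q)

  -- K c = p^c q is the common factor of the parts preceding p^c in a mixed
  -- partition.
  K : ℕ → ℕ
  K c = p ^ c * q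

  K≢0 : ∀ c → NonZero (K c)
  K≢0 c = m*n≢0 (p ^ c) q {{p^≢0 c}}

  PQ-K : ∀ c → PQ (K c)
  PQ-K c = PQ-* (Pow⇒PQ (c , refl)) PQ-q

  -- q divides no power of p, so p^a q^b is a multiple of q iff b > 0.
  q∤p^ : ∀ c → ¬ (q ∣ p ^ c)
  q∤p^ = coprime-∤-^ 1<q (coprime-sym p⊥q)

  q∤Pow : ∀ {x} → Pow x → ¬ (q ∣ x)
  q∤Pow (c , refl) = q∤p^ c

  PQ∤q⇒Pow : ∀ {x} → PQ x → ¬ (q ∣ x) → Pow x
  PQ∤q⇒Pow (a , zero , refl) _ = a , sym (*-identityʳ (p ^ a))
  PQ∤q⇒Pow (a , suc b , refl) q∤x =
    ⊥-elim (q∤x (divides (p ^ a * q ^ b) (trans (left-comm (p ^ a) q (q ^ b)) (*-comm q _))))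

  PQ-cancel-p : ∀ {y} → PQ (p * y) → PQ y
  PQ-cancel-p {y} (zero , b , e) =
    ⊥-elim (coprime-∤-^ 1<p p⊥q b (divides y (trans (sym (*-identityˡ (q ^ b))) (trans e (*-comm p y)))))
  PQ-cancel-p {y} (suc a , b , e) =
    a , b , *-cancelˡ-≡ (p ^ a * q ^ b) y p (trans (sym (*-assoc p (p ^ a) (q ^ b))) e)

  PQ-cancel-q : ∀ {y} → PQ (q * y) → PQ y
  PQ-cancel-q {y} (a , zero , e) =
    ⊥-elim (q∤p^ a (divides y (trans (sym (*-identityʳ (p ^ a))) (trans e (*-comm q y)))))
  PQ-cancel-q {y} (a , suc b , e) =
    a , b , *-cancelˡ-≡ (p ^ a * q ^ b) y q (trans (sym (left-comm (p ^ a) q (q ^ b))) e)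

  PQ-cancel-p^ : ∀ c {y} → PQ (p ^ c * y) → PQ y
  PQ-cancel-p^ zero {y} h = subst PQ (+-identityʳ y) h
  PQ-cancel-p^ (suc c) {y} h = PQ-cancel-p^ c (PQ-cancel-p (subst PQ (*-assoc p (p ^ c) y) h))

  PQ-cancel-K : ∀ c {y} → PQ (K c * y) → PQ y
  PQ-cancel-K c {y} h = PQ-cancel-q (PQ-cancel-p^ c (subst PQ (*-assoc (p ^ c) q y) h))

  ^-injective : ∀ {a b} → p ^ a ≡ p ^ b → a ≡ b
  ^-injective {a} {b} e with <-cmp a b
  ... | tri< a<b _ _ = ⊥-elim (<-irrefl e (^-monoʳ-< p 1<p a<b))
  ... | tri≈ _ a≡b _ = a≡b
  ... | tri> _ _ b<a = ⊥-elim (<-irrefl (sym e) (^-monoʳ-< p 1<p b<a))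

  Pow-∣ : ∀ {x y} → Pow x → Pow y → y < x → y ∣ x
  Pow-∣ (a , refl) (b , refl) y<x with ≤-total a b
  ... | inj₁ a≤b = ⊥-elim (<⇒≱ y<x (^-monoʳ-≤ p a≤b))
  ... | inj₂ b≤a = divides (p ^ (a ∸ b)) (begin
    p ^ a                ≡⟨ cong (p ^_) (sym (m∸n+n≡m b≤a)) ⟩
    p ^ (a ∸ b + b)      ≡⟨ ^-distribˡ-+-* p (a ∸ b) b ⟩
    p ^ (a ∸ b) * p ^ b  ∎)
    where open ≡-Reasoning

  Pow-step : ∀ {x y} → Pow x → Pow y → x < y → p * x ≤ y
  Pow-step (a , refl) (b , refl) x<y with <-cmp a b
  ... | tri< a<b _ _ = ^-monoʳ-≤ p a<b
  ... | tri≈ _ refl _ = ⊥-elim (<-irrefl refl x<y)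
  ... | tri> _ _ b<a = ⊥-elim (<⇒≱ x<y (<⇒≤ (^-monoʳ-< p 1<p b<a)))

  K∣ : ∀ c {x} → p ^ c ∣ x → q ∣ x → K c ∣ x
  K∣ c (divides m refl) q∣x with coprime-divisor-^ (coprime-sym p⊥q) c (subst (q ∣_) (*-comm m (p ^ c)) q∣x)
  ... | divides k refl = divides k (begin
    k * q * p ^ c    ≡⟨ *-assoc k q (p ^ c) ⟩
    k * (q * p ^ c)  ≡⟨ cong (k *_) (*-comm q (p ^ c)) ⟩
    k * K c          ∎)
    where open ≡-Reasoning

  -- Strictly chained partitions and partitions into distinct powers of p,
  -- stated directly (Defs encodes them through bounded searches and Linked).
  SCP : ℕ → List ℕ → Set
  SCP U xs = All PQ xs × AllPairs Chained xs × sum xs ≡ U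

  PPart : ℕ → List ℕ → Set
  PPart T zs = All Pow zs × Decreasing zs × sum zs ≡ T

  IsSCP⇒SCP : ∀ {U xs} → IsSCP p q U xs → SCP U xs
  IsSCP⇒SCP (pqs , chain , s) = All.map IsPQ⇒PQ pqs , Linked⇒AllPairs Chained-trans chain , s

  SCP⇒IsSCP : ∀ {U xs} → SCP U xs → IsSCP p q U xs
  SCP⇒IsSCP (pqs , chain , s) = All.map PQ⇒IsPQ pqs , AllPairs⇒Linked chain , s

  IsPPart⇒PPart : ∀ {T zs} → IsPPart p T zs → PPart T zs
  IsPPart⇒PPart (pows , dec , s) = All.map IsPow⇒Pow pows , Linked⇒AllPairs (λ y<x z<y → <-trans z<y y<x) dec , s

  PPart⇒IsPPart : ∀ {T zs} → PPart T zs → IsPPart p T zs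
  PPart⇒IsPPart (pows , dec , s) = All.map Pow⇒IsPow pows , AllPairs⇒Linked dec , s

  candidates : ℕ → List (List ℕ)
  candidates U = sublists (downFrom1 U)

  count : ℕ → {P : Pred (List ℕ) 0ℓ} → Decidable P → ℕ
  count U P? = length (filter P? (candidates U))

  filtered-unique : ∀ U {P : Pred (List ℕ) 0ℓ} (P? : Decidable P) → Unique (filter P? (candidates U))
  filtered-unique U P? = UniqueP.filter⁺ P? (sublists-unique U)

  SCP⇒candidate : ∀ {U xs} → SCP U xs → xs ∈ candidates U
  SCP⇒candidate (pqs , chain , refl) = positive-decreasing⇒candidate (All.map PQ-pos pqs) (AllPairs.map proj₁ chain)

  PPart⇒candidate : ∀ {T zs} → PPart T zs → zs ∈ candidates T
  PPart⇒candidate (pows , dec , refl) = positive-decreasing⇒candidate (All.map Pow-pos pows) dec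

  SCPs : ℕ → List (List ℕ)
  SCPs U = filter (isSCP? p q U) (candidates U)

  ∈-SCPs⁺ : ∀ {U xs} → SCP U xs → xs ∈ SCPs U
  ∈-SCPs⁺ h = ∈-filter⁺ (isSCP? p q _) (SCP⇒candidate h) (SCP⇒IsSCP h)

  ∈-SCPs⁻ : ∀ {U xs} → xs ∈ SCPs U → SCP U xs
  ∈-SCPs⁻ {U} m = IsSCP⇒SCP (proj₂ (∈-filter⁻ (isSCP? p q U) {xs = candidates U} m))

  scale-SCP : ∀ d .{{_ : NonZero d}} {M ys} → (∀ {y} → PQ y → PQ (d * y)) →
              SCP M ys → SCP (d * M) (map (d *_) ys)
  scale-SCP d {M} {ys} pq (pqs , chain , s) =
    AllP.map⁺ (All.map pq pqs) ,
    AllPairsP.map⁺ (AllPairs.map (λ (lt , dv) → *-monoʳ-< d lt , *-monoʳ-∣ d dv) chain) ,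
    trans (sum-map-* d ys) (cong (d *_) s)

  unscale-SCP : ∀ d .{{_ : NonZero d}} {M ys} → (∀ {y} → PQ (d * y) → PQ y) →
                SCP (d * M) (map (d *_) ys) → SCP M ys
  unscale-SCP d {M} {ys} pq (pqs , chain , s) =
    All.map pq (AllP.map⁻ pqs) ,
    AllPairs.map (λ {x} {y} (lt , dv) → *-cancelˡ-< d y x lt , *-cancelˡ-∣ d dv) (AllPairsP.map⁻ chain) ,
    *-cancelˡ-≡ (sum ys) M d (trans (sym (sum-map-* d ys)) s)

  Pow-chain : ∀ {xs} → All Pow xs → Decreasing xs → AllPairs Chained xs
  Pow-chain [] [] = []
  Pow-chain (px ∷ pxs) (below ∷ dec) =
    All.zipWith (λ (y<x , py) → y<x , Pow-∣ px py y<x) (below , pxs) ∷ Pow-chain pxs dec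

  -- Uniqueness of base-p expansions with digits 0 and 1.  A sum of distinct
  -- powers of p below the power x stays below x ...
  sum-below-power : ∀ zs {x} → Pow x → All Pow zs → Decreasing zs → All (_< x) zs → sum zs < x
  sum-below-power [] px _ _ _ = Pow-pos px
  sum-below-power (z ∷ zs) {x} px (pz ∷ pzs) (below ∷ dec) (z<x ∷ _) = begin-strict
    z + sum zs  <⟨ +-monoʳ-< z (sum-below-power zs pz pzs dec below) ⟩
    z + z       ≡⟨ cong (z +_) (sym (+-identityʳ z)) ⟩
    2 * z       ≤⟨ *-monoˡ-≤ z 1<p ⟩
    p * z       ≤⟨ Pow-step pz px z<x ⟩
    x           ∎
    where open ≤-Reasoning

  sum-below-next-power : ∀ {z zs} → All Pow (z ∷ zs) → Decreasing (z ∷ zs) → sum (z ∷ zs) < p * z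
  sum-below-next-power {z} pows@((a , refl) ∷ _) dec@(below ∷ _) =
    sum-below-power (z ∷ _) (suc a , refl) pows dec (z<pz ∷ All.map (λ y<z → <-trans y<z z<pz) below)
    where z<pz = ^-monoʳ-< p 1<p (n<1+n a)

  smaller-head-impossible : ∀ {T a as b bs} → PPart T (a ∷ as) → PPart T (b ∷ bs) → a < b → ⊥
  smaller-head-impossible {a = a} {as} {b} {bs} (pa , da , ea) (pb ∷ _ , _ , eb) a<b =
    <⇒≱ (begin-strict
      sum (a ∷ as)  <⟨ sum-below-next-power pa da ⟩
      p * a         ≤⟨ Pow-step (All.head pa) pb a<b ⟩
      b             ≤⟨ m≤m+n b (sum bs) ⟩
      sum (b ∷ bs)  ∎) (≤-reflexive (trans eb (sym ea)))
    where open ≤-Reasoning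

  PPart-unique : ∀ {T} zs zs′ → PPart T zs → PPart T zs′ → zs ≡ zs′
  PPart-unique [] [] _ _ = refl
  PPart-unique [] (z ∷ zs) (_ , _ , refl) (pz ∷ _ , _ , e) =
    ⊥-elim (<⇒≱ (Pow-pos pz) (subst (z ≤_) e (m≤m+n z (sum zs))))
  PPart-unique (z ∷ zs) [] (pz ∷ _ , _ , e) (_ , _ , refl) =
    ⊥-elim (<⇒≱ (Pow-pos pz) (subst (z ≤_) e (m≤m+n z (sum zs))))
  PPart-unique (z ∷ zs) (z′ ∷ zs′) h@(_ ∷ pzs , _ ∷ dzs , e) h′@(_ ∷ pzs′ , _ ∷ dzs′ , e′) with <-cmp z z′
  ... | tri< z<z′ _ _ = ⊥-elim (smaller-head-impossible h h′ z<z′)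
  ... | tri> _ _ z′<z = ⊥-elim (smaller-head-impossible h′ h z′<z)
  ... | tri≈ _ refl _ = cong (z ∷_) (PPart-unique zs zs′ (pzs , dzs , refl)
                          (pzs′ , dzs′ , +-cancelˡ-≡ z (sum zs′) (sum zs) (trans e′ (sym e))))

  Wp≡1 : ∀ {T zs} → PPart T zs → Wp p T ≡ 1
  Wp≡1 {T} {zs} h = length-by-members (filtered-unique T (isPPart? p T)) ([] ∷ []) (mk⇔ to from)
    where
    to : ∀ {z} → z ∈ filter (isPPart? p T) (candidates T) → z ∈ zs ∷ []
    to m = here (PPart-unique _ _ (IsPPart⇒PPart (proj₂ (∈-filter⁻ (isPPart? p T) {xs = candidates T} m))) h)
    from : ∀ {z} → z ∈ zs ∷ [] → z ∈ filter (isPPart? p T) (candidates T)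
    from (here refl) = ∈-filter⁺ (isPPart? p T) (PPart⇒candidate h) (PPart⇒IsPPart h)

  Wp≡1⇒PPart : ∀ {T} → Wp p T ≡ 1 → ∃ (PPart T)
  Wp≡1⇒PPart {T} e with zs , m ← nonempty-member (filter (isPPart? p T) (candidates T)) (≤-reflexive (sym e)) =
    zs , IsPPart⇒PPart (proj₂ (∈-filter⁻ (isPPart? p T) {xs = candidates T} m))

  fnm : List ℕ → ℕ
  fnm = firstNonMultiple q

  Pure? : ∀ U → Decidable (λ xs → IsSCP p q U xs × ¬ (q ∣ head₀ xs))
  Pure? U xs = isSCP? p q U xs ×-dec ¬? (q ∣? head₀ xs)

  QHead : ℕ → Pred (List ℕ) 0ℓ
  QHead U xs = IsSCP p q U xs × q ∣ head₀ xs

  QHead? : ∀ U → Decidable (QHead U)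
  QHead? U xs = isSCP? p q U xs ×-dec (q ∣? head₀ xs)

  AllQ? : ∀ U → Decidable (λ xs → QHead U xs × fnm xs ≡ 0)
  AllQ? U xs = QHead? U xs ×-dec (fnm xs ≟ 0)

  Mixed : ℕ → ℕ → Pred (List ℕ) 0ℓ
  Mixed U c xs = QHead U xs × fnm xs ≡ p ^ c

  Mixed? : ∀ U c → Decidable (Mixed U c)
  Mixed? U c xs = QHead? U xs ×-dec (fnm xs ≟ p ^ c)

  MixedBelow? : ∀ U N → Decidable (λ xs → QHead U xs × Any (λ c → fnm xs ≡ p ^ c) (upTo N))
  MixedBelow? U N xs = QHead? U xs ×-dec any? (λ c → fnm xs ≟ p ^ c) (upTo N)

  -- Pure partitions.  Every part divides the largest one, so if q does not
  -- divide the largest part, all parts are powers of p.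
  pure⇒PPart : ∀ {U xs} → SCP U xs → ¬ (q ∣ head₀ xs) → PPart U xs
  pure⇒PPart {xs = []} (_ , _ , s) _ = [] , [] , s
  pure⇒PPart {xs = x ∷ xs} (pqs , chain@(below ∷ _) , s) q∤x =
    All.zipWith (λ (pq , q∤) → PQ∤q⇒Pow pq q∤)
      (pqs , q∤x ∷ All.map (λ (_ , y∣x) q∣y → q∤x (∣-trans q∣y y∣x)) below) ,
    AllPairs.map proj₁ chain , s

  PPart⇒pure : ∀ {U xs} → 0 < U → PPart U xs → SCP U xs × ¬ (q ∣ head₀ xs)
  PPart⇒pure {xs = []} 0<U (_ , _ , refl) = ⊥-elim (<-irrefl refl 0<U)
  PPart⇒pure {xs = x ∷ xs} _ (pows , dec , s) =
    (All.map Pow⇒PQ pows , Pow-chain pows dec , s) , q∤Pow (All.head pows)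

  count-pure : ∀ U → 0 < U → count U (Pure? U) ≡ Wp p U
  count-pure U 0<U = cong length (filter-≐ (Pure? U) (isPPart? p U) (to , from) (candidates U))
    where
    to : ∀ {xs} → IsSCP p q U xs × ¬ (q ∣ head₀ xs) → IsPPart p U xs
    to (s , q∤) = PPart⇒IsPPart (pure⇒PPart (IsSCP⇒SCP s) q∤)
    from : ∀ {xs} → IsPPart p U xs → IsSCP p q U xs × ¬ (q ∣ head₀ xs)
    from h with s , q∤ ← PPart⇒pure 0<U (IsPPart⇒PPart h) = SCP⇒IsSCP s , q∤

  count-allQ-∤ : ∀ {U} → ¬ (q ∣ U) → count U (AllQ? U) ≡ 0
  count-allQ-∤ {U} q∤U = cong length (filter-none (AllQ? U) {xs = candidates U} (All.tabulate (λ _ → not-allQ)))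
    where
    not-allQ : ∀ {xs} → ¬ (QHead U xs × fnm xs ≡ 0)
    not-allQ {xs} ((s , _) , none) with _ , _ , s≡U ← IsSCP⇒SCP s =
      q∤U (subst (q ∣_) s≡U (multiples-sum xs (firstNonMultiple≡0 q xs none)))

  count-allQ-∣ : ∀ M → count (M * q) (AllQ? (M * q)) ≡ W p q M
  count-allQ-∣ M = sym (length-by-bijection (filtered-unique M (isSCP? p q M)) (filtered-unique U (AllQ? U))
                         (map (q *_)) (map-injective (*-cancelˡ-≡ _ _ q)) into onto)
    where
    U = M * q
    into : ∀ {ys} → ys ∈ SCPs M → map (q *_) ys ∈ filter (AllQ? U) (candidates U)
    into {ys} m = ∈-filter⁺ (AllQ? U) (SCP⇒candidate scaled)
                    ((SCP⇒IsSCP scaled , multiples-head _ (multiples-map q ys)) , firstNonMultiple-all q _ (multiples-map q ys))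
      where scaled = subst (λ u → SCP u (map (q *_) ys)) (*-comm q M) (scale-SCP q (PQ-* PQ-q) (∈-SCPs⁻ m))
    onto : ∀ {xs} → xs ∈ filter (AllQ? U) (candidates U) → ∃ λ ys → ys ∈ SCPs M × xs ≡ map (q *_) ys
    onto {xs} m with (s , _) , none ← proj₂ (∈-filter⁻ (AllQ? U) {xs = candidates U} m)
                  with ys , refl ← all-multiples q xs (firstNonMultiple≡0 q xs none) =
      ys , ∈-SCPs⁺ (unscale-SCP q PQ-cancel-q (subst (λ u → SCP u (map (q *_) ys)) (*-comm M q) (IsSCP⇒SCP s))) , refl

  count-allQ : ∀ U → count U (AllQ? U) ≡ Wfrac p q U q
  count-allQ U with q ∣? U
  ... | no q∤U = count-allQ-∤ q∤U
  ... | yes (divides M refl) = trans (count-allQ-∣ M) (cong (W p q) (sym (trans (fdiv≡/ (M * q) q) (m*n/n≡m M q))))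

  mixed : ℕ → List ℕ → List ℕ → List ℕ
  mixed c ys zs = map (K c *_) ys ++ p ^ c ∷ zs

  -- The parts before p^c are multiples of q (p^c is the first non-multiple)
  -- and of p^c (they precede it in the chain), hence of K c; the parts after
  -- p^c divide it, so they are powers of p below p^c.
  decompose : ∀ {U c} as zs → SCP U (as ++ p ^ c ∷ zs) → All (q ∣_) as →
    ∃ λ ys → as ≡ map (K c *_) ys × SCP (sum ys) ys × PPart (sum zs) zs ×
             sum zs < p ^ c × U ≡ K c * sum ys + (p ^ c + sum zs)
  decompose {U} {c} as zs (pqs , chain , s) q∣as with AllPairs-++⁻ as chain
  ... | as-chain , below-p^c ∷ zs-chain , across
    with all-multiples (K c) as (All.zipWith (λ (q∣a , a-above) → K∣ c (proj₂ (All.head a-above)) q∣a) (q∣as , across))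
  ...   | ys , refl = ys , refl , ys-SCP , (zs-Pow , zs-dec , refl) , zs<p^c , U≡
    where
    instance _ = K≢0 c
    ys-SCP : SCP (sum ys) ys
    ys-SCP = unscale-SCP (K c) (PQ-cancel-K c) (AllP.++⁻ˡ (map (K c *_) ys) pqs , as-chain , sum-map-* (K c) ys)
    zs-dec : Decreasing zs
    zs-dec = AllPairs.map proj₁ zs-chain
    zs-Pow : All Pow zs
    zs-Pow = All.zipWith (λ (pq , (_ , z∣p^c)) → PQ∤q⇒Pow pq (λ q∣z → q∤p^ c (∣-trans q∣z z∣p^c)))
               (All.tail (AllP.++⁻ʳ (map (K c *_) ys) pqs) , below-p^c)
    zs<p^c : sum zs < p ^ c
    zs<p^c = sum-below-power zs (c , refl) zs-Pow zs-dec (All.map proj₁ below-p^c)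
    U≡ : U ≡ K c * sum ys + (p ^ c + sum zs)
    U≡ = trans (sym s) (trans (sum-++ (map (K c *_) ys) (p ^ c ∷ zs)) (cong (_+ (p ^ c + sum zs)) (sum-map-* (K c) ys)))

  -- Every mixed partition decomposes, with ys nonempty because the largest
  -- part is a multiple of q while p^c is not.
  decompose-mixed : ∀ {U c xs} → Mixed U c xs →
    ∃ λ ys → ∃ λ zs → xs ≡ mixed c ys zs × SCP (sum ys) ys × 0 < sum ys × PPart (sum zs) zs ×
                     sum zs < p ^ c × U ≡ K c * sum ys + (p ^ c + sum zs)
  decompose-mixed {U} {c} {xs} ((s , q∣head) , first)
    with firstNonMultiple-split q xs (λ e → <⇒≢ (m^n>0 p c) (sym (trans (sym first) e)))
  ... | as , zs , xs≡ , q∣as , _ with subst (λ v → xs ≡ as ++ v ∷ zs) first xs≡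
  ...   | refl with decompose {c = c} as zs (IsSCP⇒SCP s) q∣as
  ...     | ys , refl , ys-SCP , rest = ys , zs , refl , ys-SCP , ys-pos ys q∣head ys-SCP , rest
    where
    ys-pos : ∀ ys → q ∣ head₀ (mixed c ys zs) → SCP (sum ys) ys → 0 < sum ys
    ys-pos [] q∣p^c _ = ⊥-elim (q∤p^ c q∣p^c)
    ys-pos (y ∷ ys) _ (pq ∷ _ , _) = ≤-trans (PQ-pos pq) (m≤m+n y (sum ys))

  assemble : ∀ {U c M T ys zs} → SCP M ys → 0 < M → PPart T zs → T < p ^ c →
             U ≡ K c * M + (p ^ c + T) → SCP U (mixed c ys zs) × Mixed U c (mixed c ys zs)
  assemble {U} {c} {M} {T} {ys} {zs} ys-SCP@(ys-PQ , _ , ys≡M) 0<M (zs-Pow , zs-dec , zs≡T) T<p^c U≡ =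
    scp , (SCP⇒IsSCP scp , head-multiple ys ys≡M) , first
    where
    instance _ = K≢0 c
    below-p^c : All (Chained (p ^ c)) zs
    below-p^c = All.zipWith (λ (z<p^c , pz) → z<p^c , Pow-∣ (c , refl) pz z<p^c)
                  (All.map (λ z≤ → ≤-<-trans z≤ (subst (_< p ^ c) (sym zs≡T) T<p^c)) (all-≤-sum zs) , zs-Pow)
    above : ∀ {y} → PQ y → All (Chained (K c * y)) (p ^ c ∷ zs)
    above {y} pq = step ∷ All.map (Chained-trans step) below-p^c
      where step = <-≤-trans (m<m*n (p ^ c) q {{p^≢0 c}} 1<q) (m≤m*n (K c) y {{>-nonZero (PQ-pos pq)}}) ,
                   divides (q * y) (trans (*-assoc (p ^ c) q y) (*-comm (p ^ c) (q * y)))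
    scp : SCP U (mixed c ys zs)
    scp = AllP.++⁺ (AllP.map⁺ (All.map (PQ-* (PQ-K c)) ys-PQ)) (Pow⇒PQ (c , refl) ∷ All.map Pow⇒PQ zs-Pow) ,
          AllPairsP.++⁺ (proj₁ (proj₂ (scale-SCP (K c) (PQ-* (PQ-K c)) ys-SCP)))
                        (below-p^c ∷ Pow-chain zs-Pow zs-dec) (AllP.map⁺ (All.map above ys-PQ)) ,
          trans (sum-++ (map (K c *_) ys) (p ^ c ∷ zs))
            (trans (cong₂ (λ m t → m + (p ^ c + t)) (trans (sum-map-* (K c) ys) (cong (K c *_) ys≡M)) zs≡T) (sym U≡))
    head-multiple : ∀ ys → sum ys ≡ M → q ∣ head₀ (mixed c ys zs)
    head-multiple [] 0≡M = ⊥-elim (<-irrefl 0≡M 0<M)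
    head-multiple (y ∷ _) _ =
      divides (p ^ c * y) (trans (cong (_* y) (*-comm (p ^ c) q)) (trans (*-assoc q (p ^ c) y) (*-comm q _)))
    first : fnm (mixed c ys zs) ≡ p ^ c
    first = trans (firstNonMultiple-++ q (map (K c *_) ys) (p ^ c ∷ zs) multiples-K) (firstNonMultiple-∷ q zs (q∤p^ c))
      where multiples-K : All (q ∣_) (map (K c *_) ys)
            multiples-K = AllP.map⁺ (All.universal (λ y → ∣-trans (n∣m*n (p ^ c)) (m∣m*n y)) ys)

  open DeltaConditions 1<q

  mixed⇒conditions : ∀ {U c xs} → Mixed U c xs →
    p ^ c * (q + 1) ≤ U × fmod (fdiv U (p ^ c)) q ≡ fmod 1 q × Wp p (fmod U (p ^ c)) ≡ 1
  mixed⇒conditions {U} {c} h with decompose-mixed {c = c} h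
  ... | _ , _ , _ , _ , ys-pos , zs-PPart , zs<p^c , U≡
    with shape⇒conditions {P = p ^ c} {{p^≢0 c}} {{K≢0 c}} U≡ zs<p^c ys-pos
  ...   | bound , digit , remainder , _ = bound , digit , trans (cong (Wp p) remainder) (Wp≡1 zs-PPart)

  count-mixed-none : ∀ {U c} →
    ¬ (p ^ c * (q + 1) ≤ U × fmod (fdiv U (p ^ c)) q ≡ fmod 1 q × Wp p (fmod U (p ^ c)) ≡ 1) →
    count U (Mixed? U c) ≡ 0
  count-mixed-none {U} {c} fails =
    cong length (filter-none (Mixed? U c) {xs = candidates U} (All.universal (λ _ → fails ∘ mixed⇒conditions {c = c}) _))

  -- When the δ-conditions hold, ys ↦ K c · ys ++ p^c ∷ zs₀, with zs₀ the
  -- expansion of U mod p^c, is a bijection from the partitions of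
  -- ⌊U/(p^c q)⌋ to the mixed partitions of U with first non-multiple p^c.
  count-mixed-exists : ∀ {U c} → p ^ c * (q + 1) ≤ U → fmod (fdiv U (p ^ c)) q ≡ fmod 1 q →
    Wp p (fmod U (p ^ c)) ≡ 1 → count U (Mixed? U c) ≡ W p q (fdiv U (K c))
  count-mixed-exists {U} {c} bound digit expansion
    with conditions⇒shape {P = p ^ c} {{p^≢0 c}} {{K≢0 c}} bound digit | Wp≡1⇒PPart expansion
  ... | U≡ , T<p^c , M≥1 | zs₀ , zs₀-PPart =
    sym (length-by-bijection (filtered-unique M (isSCP? p q M)) (filtered-unique U (Mixed? U c))
           (λ ys → mixed c ys zs₀) injective into onto)
    where
    M = fdiv U (K c)
    injective : ∀ {a b} → mixed c a zs₀ ≡ mixed c b zs₀ → a ≡ b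
    injective {a} {b} e = map-injective (*-cancelˡ-≡ _ _ (K c) {{K≢0 c}})
                            (++-cancelʳ (p ^ c ∷ zs₀) (map (K c *_) a) (map (K c *_) b) e)
    into : ∀ {ys} → ys ∈ SCPs M → mixed c ys zs₀ ∈ filter (Mixed? U c) (candidates U)
    into m with scp , mix ← assemble {c = c} (∈-SCPs⁻ m) M≥1 zs₀-PPart T<p^c U≡ =
      ∈-filter⁺ (Mixed? U c) (SCP⇒candidate scp) mix
    onto : ∀ {xs} → xs ∈ filter (Mixed? U c) (candidates U) → ∃ λ ys → ys ∈ SCPs M × xs ≡ mixed c ys zs₀
    onto m with decompose-mixed {c = c} (proj₂ (∈-filter⁻ (Mixed? U c) {xs = candidates U} m))
    ... | ys , zs , refl , ys-SCP , ys-pos , zs-PPart , zs<p^c , U≡′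
      with shape⇒conditions {P = p ^ c} {{p^≢0 c}} {{K≢0 c}} U≡′ zs<p^c ys-pos
    ...   | _ , _ , remainder , quotient =
      ys , ∈-SCPs⁺ (subst (λ u → SCP u ys) (sym quotient) ys-SCP) ,
      cong (mixed c ys) (PPart-unique zs zs₀ (subst (λ t → PPart t zs) (sym remainder) zs-PPart) zs₀-PPart)

  summand : ∀ U c → Dec (p ^ c * (q + 1) ≤ U) → Dec (fmod (fdiv U (p ^ c)) q ≡ fmod 1 q) →
            Dec (Wp p (fmod U (p ^ c)) ≡ 1) → ℕ
  summand U c bound? digit? expansion? =
    if does bound?
      then (if does digit? then (if does expansion? then 1 else 0) else 0) * W p q (fdiv U (p ^ c * q))
      else 0

  count-mixed : ∀ U c bound? digit? expansion? → count U (Mixed? U c) ≡ summand U c bound? digit? expansion?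
  count-mixed U c (yes bound) (yes digit) (yes expansion) =
    trans (count-mixed-exists {U} {c} bound digit expansion) (sym (+-identityʳ _))
  count-mixed U c (no ¬bound) _ _ = count-mixed-none {U} {c} (λ (bound , _) → ¬bound bound)
  count-mixed U c (yes _) (no ¬digit) _ = count-mixed-none {U} {c} (λ (_ , digit , _) → ¬digit digit)
  count-mixed U c (yes _) (yes _) (no ¬expansion) = count-mixed-none {U} {c} (λ (_ , _ , expansion) → ¬expansion expansion)

  count-mixed-total : ∀ U → sum (map (λ c → count U (Mixed? U c)) (upTo (suc U))) ≡ sumTerm p q U
  count-mixed-total U = cong sum (map-cong (λ c → count-mixed U c (p ^ c * (q + 1) ≤? U)
                          (fmod (fdiv U (p ^ c)) q ≟ fmod 1 q) (Wp p (fmod U (p ^ c)) ≟ 1)) (upTo (suc U)))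

  split-pure : ∀ U → W p q U ≡ count U (Pure? U) + count U (QHead? U)
  split-pure U = length-filter-split (isSCP? p q U) (Pure? U) (QHead? U) classify proj₁ proj₁
                   (λ (_ , q∤) (_ , q∣) → q∤ q∣) (candidates U)
    where
    classify : ∀ {xs} → IsSCP p q U xs → (IsSCP p q U xs × ¬ (q ∣ head₀ xs)) ⊎ QHead U xs
    classify {xs} s with q ∣? head₀ xs
    ... | yes q∣ = inj₂ (s , q∣)
    ... | no q∤  = inj₁ (s , q∤)

  first-nonmultiple-power : ∀ {U xs} → SCP U xs → fnm xs ≢ 0 → ∃ λ c → c < suc U × fnm xs ≡ p ^ c
  first-nonmultiple-power {U} {xs} (pqs , _ , s) some with firstNonMultiple-∈ q xs some
  ... | ∈xs , q∤ with PQ∤q⇒Pow (All.lookup pqs ∈xs) q∤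
  ...   | c , p^c≡ = c , s≤s c≤U , sym p^c≡
    where
    c≤U : c ≤ U
    c≤U = ≤-trans (<⇒≤ (n<m^n 1<p c))
            (≤-trans (≤-reflexive p^c≡) (≤-trans (All.lookup (all-≤-sum xs) ∈xs) (≤-reflexive s)))

  split-qhead : ∀ U → count U (QHead? U) ≡ count U (AllQ? U) + count U (MixedBelow? U (suc U))
  split-qhead U = length-filter-split (QHead? U) (AllQ? U) (MixedBelow? U (suc U)) classify proj₁ proj₁
                    disjoint (candidates U)
    where
    classify : ∀ {xs} → QHead U xs →
      (QHead U xs × fnm xs ≡ 0) ⊎ (QHead U xs × Any (λ c → fnm xs ≡ p ^ c) (upTo (suc U)))
    classify {xs} h with fnm xs ≟ 0
    ... | yes none = inj₁ (h , none)
    ... | no some with first-nonmultiple-power (IsSCP⇒SCP (proj₁ h)) some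
    ...   | c , c≤U , first = inj₂ (h , lose (∈-upTo⁺ c≤U) first)
    disjoint : ∀ {xs} → QHead U xs × fnm xs ≡ 0 → QHead U xs × Any (λ c → fnm xs ≡ p ^ c) (upTo (suc U)) → ⊥
    disjoint (_ , none) (_ , some) with c , _ , first ← find some = <⇒≢ (m^n>0 p c) (trans (sym none) first)

  split-mixed : ∀ U N → count U (MixedBelow? U N) ≡ sum (map (λ c → count U (Mixed? U c)) (upTo N))
  split-mixed U zero =
    cong length (filter-none (MixedBelow? U 0) {xs = candidates U} (All.universal (λ _ → λ { (_ , ()) }) _))
  split-mixed U (suc N) = begin
    count U (MixedBelow? U (suc N))
      ≡⟨ length-filter-split (MixedBelow? U (suc N)) (MixedBelow? U N) (Mixed? U N)
           classify widen exact disjoint (candidates U) ⟩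
    count U (MixedBelow? U N) + count U (Mixed? U N)
      ≡⟨ cong (_+ count U (Mixed? U N)) (split-mixed U N) ⟩
    sum (map (λ c → count U (Mixed? U c)) (upTo N)) + count U (Mixed? U N)
      ≡⟨ sym (sum-upTo-suc (λ c → count U (Mixed? U c)) N) ⟩
    sum (map (λ c → count U (Mixed? U c)) (upTo (suc N))) ∎
    where
    open ≡-Reasoning
    Below : ℕ → List ℕ → Set
    Below n xs = QHead U xs × Any (λ c → fnm xs ≡ p ^ c) (upTo n)
    classify : ∀ {xs} → Below (suc N) xs → Below N xs ⊎ Mixed U N xs
    classify (h , some) with find some
    ... | c , c∈ , first with <-cmp c N
    ...   | tri< c<N _ _ = inj₁ (h , lose (∈-upTo⁺ c<N) first)
    ...   | tri≈ _ refl _ = inj₂ (h , first)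
    ...   | tri> _ _ N<c = ⊥-elim (<⇒≱ (∈-upTo⁻ c∈) N<c)
    widen : ∀ {xs} → Below N xs → Below (suc N) xs
    widen (h , some) with c , c∈ , first ← find some = h , lose (∈-upTo⁺ (m<n⇒m<1+n (∈-upTo⁻ c∈))) first
    exact : ∀ {xs} → Mixed U N xs → Below (suc N) xs
    exact (h , first) = h , lose (∈-upTo⁺ (n<1+n N)) first
    disjoint : ∀ {xs} → Below N xs → Mixed U N xs → ⊥
    disjoint (_ , some) (_ , first) with c , c∈ , first′ ← find some =
      <⇒≢ (∈-upTo⁻ c∈) (^-injective (trans (sym first′) first))

theorem4p2 : (p q : ℕ) → 1 < p → 1 < q → Coprime p q → (U : ℕ) → 1 ≤ U →
    W p q U ≡ Wp p U + Wfrac p q U q + sumTerm p q U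
theorem4p2 p q 1<p 1<q p⊥q U 0<U = begin
  W p q U
    ≡⟨ split-pure U ⟩
  count U (Pure? U) + count U (QHead? U)
    ≡⟨ cong₂ _+_ (count-pure U 0<U) (split-qhead U) ⟩
  Wp p U + (count U (AllQ? U) + count U (MixedBelow? U (suc U)))
    ≡⟨ cong₂ (λ a b → Wp p U + (a + b)) (count-allQ U) (split-mixed U (suc U)) ⟩
  Wp p U + (Wfrac p q U q + sum (map (λ c → count U (Mixed? U c)) (upTo (suc U))))
    ≡⟨ cong (λ s → Wp p U + (Wfrac p q U q + s)) (count-mixed-total U) ⟩
  Wp p U + (Wfrac p q U q + sumTerm p q U)
    ≡⟨ sym (+-assoc (Wp p U) (Wfrac p q U q) (sumTerm p q U)) ⟩
  Wp p U + Wfrac p q U q + sumTerm p q U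
    ∎
  where
  open Recurrence p q 1<p 1<q p⊥q
  open ≡-Reasoning
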